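{- Let $G$ be a finite simple graph with maximum degree $\Delta$ and chromatic number $\chi(G)$. Then (i) $\overrightarrow{\beta}(G,f)=1$ for every integer $f\ge\Delta$ (with $f\ge 1$), and (ii) $\overrightarrow{\beta}(G,f)\le \Delta^{\chi(G)}$ for every integer $f$ with $1\le f<\Delta$.
   Context: Firefighting on oriented graphs: an orientation $\overrightarrow{G}$ of a finite simple graph $G$ replaces each edge $uv$ by exactly one of the arcs $\overrightarrow{uv}$, $\overrightarrow{vu}$. Let $f\ge 1$ be an integer. A fire breaks out at a vertex $v$ at time $1$ ($v$ burns). At the end of each time unit, the firefighters permanently protect up to $f$ vertices that are neither burning nor already protected. At the next time unit, every vertex that is neither burning nor protected and is an out-neighbour of a burning vertex starts to burn. The process ends when no new vertex can burn. $\beta(\overrightarrow{G},f)$ is the maximum, over all starting vertices $v$, of the minimum, over all protection strategies, of the number of vertices that burn. $\overrightarrow{\beta}(G,f)$ is the minimum of $\beta(\overrightarrow{G},f)$ over all orientations $\overrightarrow{G}$ of $G$. -}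

module Defs where

open import Data.Nat using (ℕ; zero; suc; _≤_; _⊔_)
open import Data.Bool using (Bool; true; false; not; _∧_)
open import Data.Fin using (Fin)
open import Data.List using (List; allFin; foldr; map)
open import Data.Bool.ListAction using (any)
open import Data.Vec using (tabulate; lookup)
open import Data.Fin.Subset using (Subset; ∣_∣; _∪_; ⁅_⁆; ⊥; _∈_; _∉_)
open import Data.Product using (_×_; _,_; proj₁; proj₂; ∃; ∃-syntax)
open import Data.Sum using (_⊎_)
open import Relation.Binary.PropositionalEquality using (_≡_; _≢_)

record SimpleGraph (n : ℕ) : Set where
  field
    adj    : Fin n → Fin n → Bool
    sym    : ∀ u v → adj u v ≡ adj v u
    irrefl : ∀ u → adj u u ≡ false
open SimpleGraph public

degree : ∀ {n} → SimpleGraph n → Fin n → ℕ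
degree G u = ∣ tabulate (adj G u) ∣

-- maximum degree Δ(G) (0 for the graph with no vertices)
maxDegree : ∀ {n} → SimpleGraph n → ℕ
maxDegree {n} G = foldr _⊔_ 0 (map (degree G) (allFin n))

ProperColouring : ∀ {n} → SimpleGraph n → (k : ℕ) → (Fin n → Fin k) → Set
ProperColouring G k c = ∀ u v → adj G u v ≡ true → c u ≢ c v

Colourable : ∀ {n} → SimpleGraph n → ℕ → Set
Colourable {n} G k = ∃[ c ] ProperColouring G k c

IsChromaticNumber : ∀ {n} → SimpleGraph n → ℕ → Set
IsChromaticNumber G χ = Colourable G χ × (∀ k → Colourable G k → χ ≤ k)

-- arc D u v ≡ true  means the arc u → v is present
Digraph : ℕ → Set
Digraph n = Fin n → Fin n → Bool

IsOrientation : ∀ {n} → SimpleGraph n → Digraph n → Set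
IsOrientation G D =
  (∀ u v → D u v ≡ true → adj G u v ≡ true) ×
  (∀ u v → adj G u v ≡ true → (D u v ≡ true) ⊎ (D v u ≡ true)) ×
  (∀ u v → D u v ≡ true → D v u ≡ false)

-- Time index t : ℕ here corresponds to time unit t+1 of the paper.
-- A strategy gives, for each time unit, the set of vertices protected at
-- the end of that time unit.  (The process is deterministic, so adaptive
-- strategies are the same as such sequences.)

Strategy : ℕ → Set
Strategy n = ℕ → Subset n

spread : ∀ {n} → Digraph n → Subset n → Subset n → Subset n
spread {n} D B P = tabulate λ u →
  not (lookup P u) ∧ not (lookup B u) ∧
  any (λ w → lookup B w ∧ D w u) (allFin n)

-- state at time t+1: (burning set, protected set before the end of time t+1)
state : ∀ {n} → Digraph n → Fin n → Strategy n → ℕ → Subset n × Subset n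
state D v σ zero = ⁅ v ⁆ , ⊥
state D v σ (suc t) =
  let B  = proj₁ (state D v σ t)
      P  = proj₂ (state D v σ t)
      P′ = P ∪ σ t
  in (B ∪ spread D B P′) , P′

burning : ∀ {n} → Digraph n → Fin n → Strategy n → ℕ → Subset n
burning D v σ t = proj₁ (state D v σ t)

protected : ∀ {n} → Digraph n → Fin n → Strategy n → ℕ → Subset n
protected D v σ t = proj₂ (state D v σ t)

ValidStrategy : ∀ {n} → Digraph n → ℕ → Fin n → Strategy n → Set
ValidStrategy D f v σ = ∀ t →
  ∣ σ t ∣ ≤ f ×
  (∀ u → u ∈ σ t → u ∉ burning D v σ t × u ∉ protected D v σ t)

-- The burnt vertices are those burning at some time; burning sets are
-- increasing, so this number is the supremum of |burning t|.
BurnedAtMost : ∀ {n} → Digraph n → Fin n → Strategy n → ℕ → Set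
BurnedAtMost D v σ k = ∀ t → ∣ burning D v σ t ∣ ≤ k

BurnedAtLeast : ∀ {n} → Digraph n → Fin n → Strategy n → ℕ → Set
BurnedAtLeast D v σ k = ∃[ t ] k ≤ ∣ burning D v σ t ∣

BetaAtMost : ∀ {n} → Digraph n → ℕ → ℕ → Set
BetaAtMost D f k = ∀ v → ∃[ σ ] (ValidStrategy D f v σ × BurnedAtMost D v σ k)

BetaAtLeast : ∀ {n} → Digraph n → ℕ → ℕ → Set
BetaAtLeast D f k = ∃[ v ] (∀ σ → ValidStrategy D f v σ → BurnedAtLeast D v σ k)

OrientedBetaAtMost : ∀ {n} → SimpleGraph n → ℕ → ℕ → Set
OrientedBetaAtMost G f k = ∃[ D ] (IsOrientation G D × BetaAtMost D f k)

OrientedBetaAtLeast : ∀ {n} → SimpleGraph n → ℕ → ℕ → Set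
OrientedBetaAtLeast G f k = ∀ D → IsOrientation G D → BetaAtLeast D f k

OrientedBetaIs : ∀ {n} → SimpleGraph n → ℕ → ℕ → Set
OrientedBetaIs G f k = OrientedBetaAtMost G f k × OrientedBetaAtLeast G f k

-- Both parts use the same orientation: for a proper colouring c, orient
-- every edge from the smaller to the larger colour.  Colours then strictly
-- increase along arcs, so the digraph is loopless and every walk from the
-- start vertex has fewer arcs than there are colours; out-degrees are at
-- most the maximum degree Δ of G.
--
-- (i)  With c the identity colouring and f ≥ Δ, protecting all out-
--      neighbours of the start vertex in the first round stops the fire
--      at once; and a fire always burns at least its start vertex.
-- (ii) With c a χ-colouring and no protection at all, every burnt vertex
--      lies in one of the layers N⁺⁽ˡ⁾(v), ℓ < χ, of out-neighbourhoods of
--      the start vertex v; layer ℓ has at most Δ^ℓ vertices, and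
--      Σ_{ℓ<χ} Δ^ℓ ≤ Δ^χ as soon as Δ ≥ 2.
module Submission where

open import Defs hiding (sym)
open import Data.Nat using (ℕ; zero; suc; _≤_; _<_; _^_; _+_; _*_; _⊔_; z≤n; s≤s; _<?_)
open import Data.Nat.Properties
open import Data.Product using (_×_; _,_; proj₁; proj₂; ∃-syntax; map₂)
open import Data.Sum using (_⊎_; inj₁; inj₂)
open import Data.Bool using (Bool; true; false; not; _∧_)
open import Data.Bool.Properties using (∧-conicalˡ; ∧-conicalʳ; ∧-zeroʳ; T-≡)
open import Data.Fin using (Fin; zero; suc; toℕ)
open import Data.Fin.Properties using (toℕ-injective; toℕ<n)
open import Data.Fin.Subset using (Subset; ∣_∣; _∪_; ⁅_⁆; ⊥; _∈_; _∉_; _⊆_)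
open import Data.Fin.Subset.Properties
  using (x∈p∪q⁻; p⊆p∪q; q⊆p∪q; p⊆q⇒∣p∣≤∣q∣; ∉⊥; ∣⊥∣≡0; x∈⁅x⁆; x∈⁅y⁆⇒x≡y; ∣⁅x⁆∣≡1)
open import Data.Vec using (tabulate; lookup; []; _∷_; here; there)
open import Data.Vec.Properties using ([]=⇒lookup; lookup⇒[]=; lookup∘tabulate)
open import Data.List using (List; map; allFin; foldr) renaming (_∷_ to _∷ₗ_)
open import Data.List.Membership.Propositional using () renaming (_∈_ to _∈ₗ_)
open import Data.List.Membership.Propositional.Properties using (∈-allFin)
open import Data.List.Relation.Unary.Any using (satisfied) renaming (here to hereₗ; there to thereₗ)
open import Data.List.Relation.Unary.Any.Properties using (any⁻)
open import Data.Bool.ListAction using (any)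
open import Function using (id; _∘_; Equivalence)
open import Relation.Nullary using (Dec; yes; does)
open import Relation.Nullary.Decidable using (dec-true; dec-false)
open import Relation.Binary.Definitions using (tri<; tri≈; tri>)
open import Relation.Binary.PropositionalEquality using (_≡_; refl; sym; trans; subst; cong; _≢_)
open import Data.Empty using (⊥-elim)

open Equivalence using (to; from)

∈-tabulate⁻ : ∀ {n} (p : Fin n → Bool) {x} → x ∈ tabulate p → p x ≡ true
∈-tabulate⁻ p {x} x∈ = trans (sym (lookup∘tabulate p x)) ([]=⇒lookup x∈)

∈-tabulate⁺ : ∀ {n} (p : Fin n → Bool) {x} → p x ≡ true → x ∈ tabulate p
∈-tabulate⁺ p {x} px = lookup⇒[]= x (tabulate p) (trans (lookup∘tabulate p x) px)

any-witness : ∀ {A : Set} (p : A → Bool) (xs : List A) → any p xs ≡ true → ∃[ x ] p x ≡ true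
any-witness p xs holds = map₂ (to T-≡) (satisfied (any⁻ p xs (from T-≡ holds)))

∣⊥∣≤ : ∀ {n} k → ∣ ⊥ {n} ∣ ≤ k
∣⊥∣≤ {n} k = subst (_≤ k) (sym (∣⊥∣≡0 n)) z≤n

∣p∪q∣≤∣p∣+∣q∣ : ∀ {n} (p q : Subset n) → ∣ p ∪ q ∣ ≤ ∣ p ∣ + ∣ q ∣
∣p∪q∣≤∣p∣+∣q∣ []          []          = z≤n
∣p∪q∣≤∣p∣+∣q∣ (true ∷ p)  (true ∷ q)  =
  s≤s (≤-trans (∣p∪q∣≤∣p∣+∣q∣ p q) (+-monoʳ-≤ ∣ p ∣ (n≤1+n ∣ q ∣)))
∣p∪q∣≤∣p∣+∣q∣ (true ∷ p)  (false ∷ q) = s≤s (∣p∪q∣≤∣p∣+∣q∣ p q)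
∣p∪q∣≤∣p∣+∣q∣ (false ∷ p) (true ∷ q)  =
  subst (suc ∣ p ∪ q ∣ ≤_) (sym (+-suc ∣ p ∣ ∣ q ∣)) (s≤s (∣p∪q∣≤∣p∣+∣q∣ p q))
∣p∪q∣≤∣p∣+∣q∣ (false ∷ p) (false ∷ q) = ∣p∪q∣≤∣p∣+∣q∣ p q

⋃∈ : ∀ {m n} → Subset m → (Fin m → Subset n) → Subset n
⋃∈ []          F = ⊥
⋃∈ (true ∷ S)  F = F zero ∪ ⋃∈ S (F ∘ suc)
⋃∈ (false ∷ S) F = ⋃∈ S (F ∘ suc)

⋃∈⁺ : ∀ {m n} {S : Subset m} (F : Fin m → Subset n) {w x} → w ∈ S → x ∈ F w → x ∈ ⋃∈ S F
⋃∈⁺ F here x∈Fw = p⊆p∪q _ x∈Fw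
⋃∈⁺ {S = true ∷ S}  F (there w∈S) x∈Fw = q⊆p∪q (F zero) _ (⋃∈⁺ (F ∘ suc) w∈S x∈Fw)
⋃∈⁺ {S = false ∷ S} F (there w∈S) x∈Fw = ⋃∈⁺ (F ∘ suc) w∈S x∈Fw

∣⋃∈∣≤ : ∀ {m n} (S : Subset m) (F : Fin m → Subset n) {b} →
  (∀ w → ∣ F w ∣ ≤ b) → ∣ ⋃∈ S F ∣ ≤ ∣ S ∣ * b
∣⋃∈∣≤ {n = n} [] F bound = ∣⊥∣≤ {n} 0
∣⋃∈∣≤ (true ∷ S)  F bound =
  ≤-trans (∣p∪q∣≤∣p∣+∣q∣ (F zero) _) (+-mono-≤ (bound zero) (∣⋃∈∣≤ S (F ∘ suc) (bound ∘ suc)))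
∣⋃∈∣≤ (false ∷ S) F bound = ∣⋃∈∣≤ S (F ∘ suc) (bound ∘ suc)

N⁺ : ∀ {n} → Digraph n → Fin n → Subset n
N⁺ D w = tabulate (D w)

layer : ∀ {n} → Digraph n → Fin n → ℕ → Subset n
layer D v zero    = ⁅ v ⁆
layer D v (suc ℓ) = ⋃∈ (layer D v ℓ) (N⁺ D)

ball : ∀ {n} → Digraph n → Fin n → ℕ → Subset n
ball D v zero    = ⊥
ball D v (suc k) = ball D v k ∪ layer D v k

layer⊆ball : ∀ {n} (D : Digraph n) v {ℓ} k → ℓ < k → layer D v ℓ ⊆ ball D v k
layer⊆ball D v (suc k) ℓ<1+k x∈ with m<1+n⇒m<n∨m≡n ℓ<1+k
... | inj₁ ℓ<k  = p⊆p∪q _ (layer⊆ball D v k ℓ<k x∈)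
... | inj₂ refl = q⊆p∪q (ball D v k) _ x∈

∣layer∣≤ : ∀ {n} (D : Digraph n) v {Δ} → (∀ w → ∣ N⁺ D w ∣ ≤ Δ) →
  ∀ ℓ → ∣ layer D v ℓ ∣ ≤ Δ ^ ℓ
∣layer∣≤ D v outdeg zero = ≤-reflexive (∣⁅x⁆∣≡1 v)
∣layer∣≤ D v {Δ} outdeg (suc ℓ) = begin
  ∣ ⋃∈ (layer D v ℓ) (N⁺ D) ∣ ≤⟨ ∣⋃∈∣≤ (layer D v ℓ) (N⁺ D) outdeg ⟩
  ∣ layer D v ℓ ∣ * Δ         ≤⟨ *-monoˡ-≤ Δ (∣layer∣≤ D v outdeg ℓ) ⟩
  Δ ^ ℓ * Δ                   ≡⟨ *-comm (Δ ^ ℓ) Δ ⟩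
  Δ ^ suc ℓ                   ∎
  where open ≤-Reasoning

∣ball∣≤ : ∀ {n} (D : Digraph n) v {Δ} → 2 ≤ Δ → (∀ w → ∣ N⁺ D w ∣ ≤ Δ) →
  ∀ k → ∣ ball D v k ∣ ≤ Δ ^ k
∣ball∣≤ {n} D v 2≤Δ outdeg zero = ∣⊥∣≤ {n} 1
∣ball∣≤ D v {Δ} 2≤Δ outdeg (suc k) = begin
  ∣ ball D v k ∪ layer D v k ∣     ≤⟨ ∣p∪q∣≤∣p∣+∣q∣ (ball D v k) (layer D v k) ⟩
  ∣ ball D v k ∣ + ∣ layer D v k ∣ ≤⟨ +-mono-≤ (∣ball∣≤ D v 2≤Δ outdeg k) (∣layer∣≤ D v outdeg k) ⟩
  Δ ^ k + Δ ^ k                    ≡⟨ cong (Δ ^ k +_) (sym (+-identityʳ (Δ ^ k))) ⟩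
  2 * Δ ^ k                        ≤⟨ *-monoˡ-≤ (Δ ^ k) 2≤Δ ⟩
  Δ ^ suc k                        ∎
  where open ≤-Reasoning

∉-byLookup : ∀ {n} (P : Subset n) {x} → not (lookup P x) ≡ true → x ∉ P
∉-byLookup P {x} notIn x∈P with lookup P x | []=⇒lookup x∈P
∉-byLookup P {x} () x∈P | .true | refl

spread⁻ : ∀ {n} (D : Digraph n) (B P : Subset n) {x} → x ∈ spread D B P →
  x ∉ P × ∃[ w ] (w ∈ B × D w x ≡ true)
spread⁻ {n} D B P {x} x∈ =
  ∉-byLookup P (∧-conicalˡ _ _ caught) ,
  w , lookup⇒[]= w B (∧-conicalˡ _ _ w-burnsIntoX) , ∧-conicalʳ _ _ w-burnsIntoX
  where
  burnsInto : Fin n → Fin n → Bool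
  burnsInto u w = lookup B w ∧ D w u
  caught : not (lookup P x) ∧ not (lookup B x) ∧ any (burnsInto x) (allFin n) ≡ true
  caught = ∈-tabulate⁻ (λ u → not (lookup P u) ∧ not (lookup B u) ∧ any (burnsInto u) (allFin n)) x∈
  witness : ∃[ w ] burnsInto x w ≡ true
  witness = any-witness (burnsInto x) (allFin n)
    (∧-conicalʳ (not (lookup B x)) _ (∧-conicalʳ (not (lookup P x)) _ caught))
  w : Fin n
  w = proj₁ witness
  w-burnsIntoX : lookup B w ∧ D w x ≡ true
  w-burnsIntoX = proj₂ witness

startBurns : ∀ {n} (D : Digraph n) v σ → BurnedAtLeast D v σ 1
startBurns D v σ = 0 , ≤-reflexive (sym (∣⁅x⁆∣≡1 v))

noProtection : ∀ {n} → Strategy n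
noProtection _ = ⊥

noProtection-valid : ∀ {n} (D : Digraph n) f v → ValidStrategy D f v noProtection
noProtection-valid {n} D f v t = ∣⊥∣≤ {n} f , λ u u∈⊥ → ⊥-elim (∉⊥ u∈⊥)

guard : ∀ {n} → Digraph n → Fin n → Strategy n
guard D v zero    = N⁺ D v
guard D v (suc t) = ⊥

guard-protects : ∀ {n} (D : Digraph n) v t {x} → x ∈ N⁺ D v → x ∈ protected D v (guard D v) (suc t)
guard-protects D v zero    x∈N⁺v = q⊆p∪q ⊥ (N⁺ D v) x∈N⁺v
guard-protects D v (suc t) x∈N⁺v = p⊆p∪q _ (guard-protects D v t x∈N⁺v)

-- Under the guard only the start vertex ever burns: a vertex catching fire
-- would be an out-neighbour of v, but those are all protected.
guard-confines : ∀ {n} (D : Digraph n) v t {x} → x ∈ burning D v (guard D v) t → x ≡ v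
guard-confines D v zero x∈ = x∈⁅y⁆⇒x≡y v x∈
guard-confines D v (suc t) x∈ with x∈p∪q⁻ (burning D v (guard D v) t) _ x∈
... | inj₁ x∈B = guard-confines D v t x∈B
... | inj₂ caught with spread⁻ D (burning D v (guard D v) t) _ caught
...   | unprotected , w , w∈B , arc with guard-confines D v t w∈B
...     | refl = ⊥-elim (unprotected (guard-protects D v t (∈-tabulate⁺ (D w) arc)))

guard-valid : ∀ {n} (D : Digraph n) f → (∀ u → D u u ≢ true) →
  ∀ v → ∣ N⁺ D v ∣ ≤ f → ValidStrategy D f v (guard D v)
guard-valid D f loopless v outdeg zero = outdeg , λ u u∈N⁺v → notStart u u∈N⁺v , ∉⊥
  where
  notStart : ∀ u → u ∈ N⁺ D v → u ∉ ⁅ v ⁆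
  notStart u u∈N⁺v u∈⁅v⁆ with x∈⁅y⁆⇒x≡y v u∈⁅v⁆
  ... | refl = loopless u (∈-tabulate⁻ (D u) u∈N⁺v)
guard-valid {n} D f loopless v outdeg (suc t) = ∣⊥∣≤ {n} f , λ u u∈⊥ → ⊥-elim (∉⊥ u∈⊥)

betaAtMostOne : ∀ {n} (D : Digraph n) f → (∀ u → D u u ≢ true) →
  (∀ u → ∣ N⁺ D u ∣ ≤ f) → BetaAtMost D f 1
betaAtMostOne D f loopless outdeg v =
  guard D v , guard-valid D f loopless v (outdeg v) ,
  λ t → ≤-trans (p⊆q⇒∣p∣≤∣q∣ (burnsOnlyV {t})) (≤-reflexive (∣⁅x⁆∣≡1 v))
  where
  burnsOnlyV : ∀ {t} → burning D v (guard D v) t ⊆ ⁅ v ⁆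
  burnsOnlyV {t} x∈ = subst (_∈ ⁅ v ⁆) (sym (guard-confines D v t x∈)) (x∈⁅x⁆ v)

betaAtLeastOne : ∀ {n} (D : Digraph n) f → 1 ≤ n → BetaAtLeast D f 1
betaAtLeastOne {suc n} D f _ = zero , λ σ _ → startBurns D zero σ

Increasing : ∀ {n χ} → Digraph n → (Fin n → Fin χ) → Set
Increasing D c = ∀ u w → D u w ≡ true → toℕ (c u) < toℕ (c w)

-- Every burning vertex x ends a walk from v with ℓ arcs, and the colour
-- rises by at least one along each arc.
burning⊆layers : ∀ {n χ} (D : Digraph n) (c : Fin n → Fin χ) → Increasing D c →
  ∀ v σ t {x} → x ∈ burning D v σ t → ∃[ ℓ ] (x ∈ layer D v ℓ × toℕ (c v) + ℓ ≤ toℕ (c x))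
burning⊆layers D c increasing v σ zero x∈ with x∈⁅y⁆⇒x≡y v x∈
... | refl = 0 , x∈⁅x⁆ v , ≤-reflexive (+-identityʳ (toℕ (c v)))
burning⊆layers D c increasing v σ (suc t) x∈ with x∈p∪q⁻ (burning D v σ t) _ x∈
... | inj₁ x∈B = burning⊆layers D c increasing v σ t x∈B
... | inj₂ caught with spread⁻ D (burning D v σ t) (protected D v σ t ∪ σ t) caught
...   | _ , w , w∈B , arc with burning⊆layers D c increasing v σ t w∈B
...     | ℓ , w∈layer , rise =
  suc ℓ , ⋃∈⁺ (N⁺ D) w∈layer (∈-tabulate⁺ (D w) arc) ,
  ≤-trans (≤-reflexive (+-suc (toℕ (c v)) ℓ)) (≤-trans (s≤s rise) (increasing w _ arc))

burning⊆ball : ∀ {n χ} (D : Digraph n) (c : Fin n → Fin χ) → Increasing D c →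
  ∀ v σ t → burning D v σ t ⊆ ball D v χ
burning⊆ball {χ = χ} D c increasing v σ t {x} x∈ with burning⊆layers D c increasing v σ t x∈
... | ℓ , x∈layer , rise = layer⊆ball D v χ ℓ<χ x∈layer
  where
  ℓ<χ : ℓ < χ
  ℓ<χ = ≤-<-trans (≤-trans (m≤n+m ℓ (toℕ (c v))) rise) (toℕ<n (c x))

betaAtMostColour : ∀ {n χ} (D : Digraph n) (c : Fin n → Fin χ) → Increasing D c →
  ∀ f {Δ} → 2 ≤ Δ → (∀ u → ∣ N⁺ D u ∣ ≤ Δ) → BetaAtMost D f (Δ ^ χ)
betaAtMostColour {χ = χ} D c increasing f 2≤Δ outdeg v =
  noProtection , noProtection-valid D f v ,
  λ t → ≤-trans (p⊆q⇒∣p∣≤∣q∣ (burning⊆ball D c increasing v noProtection t)) (∣ball∣≤ D v 2≤Δ outdeg χ)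

colourOrientation : ∀ {n k} → SimpleGraph n → (Fin n → Fin k) → Digraph n
colourOrientation G c u w = adj G u w ∧ does (toℕ (c u) <? toℕ (c w))

arc⇒edge : ∀ {n k} (G : SimpleGraph n) (c : Fin n → Fin k) u w →
  colourOrientation G c u w ≡ true → adj G u w ≡ true
arc⇒edge G c u w = ∧-conicalˡ (adj G u w) _

colourOrientation-increasing : ∀ {n k} (G : SimpleGraph n) (c : Fin n → Fin k) →
  Increasing (colourOrientation G c) c
colourOrientation-increasing G c u w arc =
  decided (toℕ (c u) <? toℕ (c w)) (∧-conicalʳ (adj G u w) _ arc)
  where
  decided : ∀ {P : Set} (d : Dec P) → does d ≡ true → P
  decided (yes p) _ = p

colourOrientation-loopless : ∀ {n k} (G : SimpleGraph n) (c : Fin n → Fin k) u →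
  colourOrientation G c u u ≢ true
colourOrientation-loopless G c u loop = <-irrefl refl (colourOrientation-increasing G c u u loop)

-- For a proper colouring the two endpoints of an edge have distinct
-- colours, so exactly one direction of every edge is chosen.
colourOrientation-isOrientation : ∀ {n k} (G : SimpleGraph n) (c : Fin n → Fin k) →
  ProperColouring G k c → IsOrientation G (colourOrientation G c)
colourOrientation-isOrientation G c proper = arc⇒edge G c , oneDirection , antisymmetric
  where
  oneDirection : ∀ u w → adj G u w ≡ true →
    colourOrientation G c u w ≡ true ⊎ colourOrientation G c w u ≡ true
  oneDirection u w edge with <-cmp (toℕ (c u)) (toℕ (c w))
  ... | tri< cu<cw _ _ rewrite edge = inj₁ (dec-true (toℕ (c u) <? toℕ (c w)) cu<cw)
  ... | tri≈ _ cu≡cw _ = ⊥-elim (proper u w edge (toℕ-injective cu≡cw))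
  ... | tri> _ _ cw<cu rewrite trans (SimpleGraph.sym G w u) edge =
    inj₂ (dec-true (toℕ (c w) <? toℕ (c u)) cw<cu)
  antisymmetric : ∀ u w → colourOrientation G c u w ≡ true → colourOrientation G c w u ≡ false
  antisymmetric u w arc
    rewrite dec-false (toℕ (c w) <? toℕ (c u)) (<⇒≯ (colourOrientation-increasing G c u w arc)) =
    ∧-zeroʳ (adj G w u)

identityColouring : ∀ {n} (G : SimpleGraph n) → ProperColouring G n id
identityColouring G u .u edge refl with trans (sym (irrefl G u)) edge
... | ()

≤-foldr-⊔ : ∀ {A : Set} (f : A → ℕ) (xs : List A) {x} → x ∈ₗ xs → f x ≤ foldr _⊔_ 0 (map f xs)
≤-foldr-⊔ f (x ∷ₗ xs) (hereₗ refl)  = m≤m⊔n (f x) _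
≤-foldr-⊔ f (y ∷ₗ xs) (thereₗ x∈xs) = ≤-trans (≤-foldr-⊔ f xs x∈xs) (m≤n⊔m (f y) _)

degree≤maxDegree : ∀ {n} (G : SimpleGraph n) v → degree G v ≤ maxDegree G
degree≤maxDegree {n} G v = ≤-foldr-⊔ (degree G) (allFin n) (∈-allFin v)

outDegree≤maxDegree : ∀ {n k} (G : SimpleGraph n) (c : Fin n → Fin k) v →
  ∣ N⁺ (colourOrientation G c) v ∣ ≤ maxDegree G
outDegree≤maxDegree G c v = ≤-trans (p⊆q⇒∣p∣≤∣q∣ outNbrsAreNbrs) (degree≤maxDegree G v)
  where
  outNbrsAreNbrs : N⁺ (colourOrientation G c) v ⊆ tabulate (adj G v)
  outNbrsAreNbrs x∈ =
    ∈-tabulate⁺ (adj G v) (arc⇒edge G c v _ (∈-tabulate⁻ (colourOrientation G c v) x∈))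

proposition4p1 : ∀ {n} (G : SimpleGraph n) → 1 ≤ n →
    (∀ (f : ℕ) → 1 ≤ f → maxDegree G ≤ f → OrientedBetaIs G f 1) ×
    (∀ (χ : ℕ) → IsChromaticNumber G χ →
      ∀ (f : ℕ) → 1 ≤ f → f < maxDegree G →
      OrientedBetaAtMost G f (maxDegree G ^ χ))
proposition4p1 G 1≤n = partI , partII
  where
  partI : ∀ f → 1 ≤ f → maxDegree G ≤ f → OrientedBetaIs G f 1
  partI f _ Δ≤f =
    ( colourOrientation G id
    , colourOrientation-isOrientation G id (identityColouring G)
    , betaAtMostOne _ f (colourOrientation-loopless G id)
        (λ u → ≤-trans (outDegree≤maxDegree G id u) Δ≤f) )
    , λ D _ → betaAtLeastOne D f 1≤n
  partII : ∀ χ → IsChromaticNumber G χ → ∀ f → 1 ≤ f → f < maxDegree G →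
    OrientedBetaAtMost G f (maxDegree G ^ χ)
  partII χ ((c , proper) , _) f 1≤f f<Δ =
    colourOrientation G c , colourOrientation-isOrientation G c proper ,
    betaAtMostColour _ c (colourOrientation-increasing G c) f (≤-trans (s≤s 1≤f) f<Δ)
      (outDegree≤maxDegree G c)
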